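{- Let $F$ be a field, let $A$ and $B$ be finite nonempty subsets of $F$, and let $P(x,y)\in F[x,y]$. Set $$C=\{a+b : a\in A,\ b\in B,\ \text{and}\ P(a,b)\neq 0\}.$$ If $C$ is nonempty, then $$|C|\geq |A|+|B|-\deg P-\min_{c\in C}\nu_{A,B}(c),$$ where $\nu_{A,B}(c)=|\{(a,b)\in A\times B : a+b=c\}|$.
   Context: $\deg P$ denotes the total degree of the polynomial $P$. -}

module Defs where

open import Level using (_⊔_)
open import Algebra.Bundles using (CommutativeRing)
open import Data.Nat as ℕ using (ℕ; zero; suc)
open import Data.List using (List; []; _∷_; foldr; length)
open import Data.Product using (Σ; ∃; ∃-syntax; _×_; _,_)
open import Relation.Nullary using (¬_)
open import Relation.Binary.PropositionalEquality using (_≡_)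
open import Relation.Binary.Bundles using (Setoid)
open import Data.Product.Relation.Binary.Pointwise.NonDependent using (×-setoid)
import Data.List.Membership.Setoid as Mem
import Data.List.Relation.Unary.Unique.Setoid as Uniq

record IsField {c ℓ} (R : CommutativeRing c ℓ) : Set (c ⊔ ℓ) where
  open CommutativeRing R
  field
    1≉0     : ¬ (1# ≈ 0#)
    inverse : ∀ x → ¬ (x ≈ 0#) → ∃[ y ] (x * y ≈ 1#)

record Field c ℓ : Set (Level.suc (c ⊔ ℓ)) where
  field
    commutativeRing : CommutativeRing c ℓ
    isField         : IsField commutativeRing
  open CommutativeRing commutativeRing public
  open IsField isField public

module FieldNotions {c ℓ} (F : Field c ℓ) where
  open Field F

  -- Bivariate polynomials over F, dense representation:
  -- P = [r₀, r₁, …] with rᵢ = [cᵢ₀, cᵢ₁, …] represents Σᵢ Σⱼ cᵢⱼ xⁱ yʲ.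
  Poly : Set c
  Poly = List (List Carrier)

  evalRow : List Carrier → Carrier → Carrier
  evalRow r y = foldr (λ k acc → k + y * acc) 0# r

  eval : Poly → Carrier → Carrier → Carrier
  eval P x y = foldr (λ r acc → evalRow r y + x * acc) 0# P

  lookupD : List Carrier → ℕ → Carrier
  lookupD []      _       = 0#
  lookupD (k ∷ _) zero    = k
  lookupD (_ ∷ r) (suc j) = lookupD r j

  coeff : Poly → ℕ → ℕ → Carrier
  coeff []      _       j = 0#
  coeff (r ∷ _) zero    j = lookupD r j
  coeff (_ ∷ P) (suc i) j = coeff P i j

  -- total degree: deg P = d  iff  all coefficients of monomials of total
  -- degree > d vanish and some monomial of total degree d has a nonzero
  -- coefficient.  (The zero polynomial has no degree in ℕ.)
  HasDegree : Poly → ℕ → Set ℓ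
  HasDegree P d =
    (∀ i j → d ℕ.< i ℕ.+ j → coeff P i j ≈ 0#) ×
    (∃[ i ] ∃[ j ] (i ℕ.+ j ≡ d × ¬ (coeff P i j ≈ 0#)))

  -- finite subsets of F as duplicate-free lists (w.r.t. ≈)
  open Mem setoid public using (_∈_)
  Unique : List Carrier → Set (c ⊔ ℓ)
  Unique = Uniq.Unique setoid

  pairSetoid : Setoid c ℓ
  pairSetoid = ×-setoid setoid setoid

  _∈²_ : Carrier × Carrier → List (Carrier × Carrier) → Set (c ⊔ ℓ)
  _∈²_ = Mem._∈_ pairSetoid

  Unique² : List (Carrier × Carrier) → Set (c ⊔ ℓ)
  Unique² = Uniq.Unique pairSetoid

module Submission where

-- Fix z ∈ C, witnessed by z = a₀ + b₀ with P(a₀, b₀) ≠ 0, and let A′, B′, C′, N′ be A, B, C, N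
-- with a₀, b₀, z and (a₀, b₀) removed. The polynomial
--   f(x, y) = ∏_{(a, b) ∈ N′} (x - a) · ∏_{c ∈ C′} (x + y - c) · P(x, y)
-- vanishes on A × B except at (a₀, b₀), where it does not. The iterated divided difference of f
-- over the nodes (a₀ ∷ A′) × (b₀ ∷ B′) is then f(a₀, b₀) / ∏ (a₀ - a′) ∏ (b₀ - b′) ≠ 0; but it
-- vanishes on every polynomial of total degree < |A′| + |B′| (the Combinatorial Nullstellensatz),
-- so the degree bound |N′| + |C′| + deg P of f is at least |A′| + |B′|.
-- Equality in F is not decidable, so the vanishing of f off the corner is only known up to double
-- negation; this suffices because the conclusion is a decidable inequality of natural numbers.

open import Level using (_⊔_)
open import Algebra.Bundles using (CommutativeRing; RawRing)
import Algebra.Solver.Ring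
open import Algebra.Solver.Ring.AlmostCommutativeRing
  using (fromCommutativeRing; _-Raw-AlmostCommutative⟶_)
open import Data.Empty using (⊥-elim)
open import Data.List using (List; []; _∷_; length; map)
open import Data.List.Properties using (length-map; length-removeAt′)
open import Data.List.Relation.Unary.All as All using (All; []; _∷_)
open import Data.List.Relation.Unary.All.Properties as All using (─⁺)
open import Data.List.Relation.Unary.AllPairs using (_∷_) renaming (head to AllPairs-head; tail to AllPairs-tail)
open import Data.List.Relation.Unary.Any as Any using (here; there; _─_)
open import Data.List.Relation.Unary.Any.Properties as Any using ()
open import Data.Maybe using (Maybe; just; nothing)
open import Data.Nat as ℕ using (ℕ; zero; suc; _∸_; _<_; _≤_; s≤s)
import Data.Nat.Properties as ℕ
open import Data.Nat.Tactic.RingSolver using (solve-∀)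
open import Data.Product using (_×_; _,_; proj₁; proj₂; ∃-syntax)
open import Data.Sum as Sum using (_⊎_; inj₁; inj₂)
open import Function.Base using (_∘_)
open import Function.Bundles using (_⇔_; Equivalence)
open import Relation.Binary.Bundles using (Setoid)
open import Relation.Binary.PropositionalEquality as ≡ using (_≡_)
open import Relation.Nullary using (¬_; Dec; yes; no)
open import Relation.Nullary.Decidable using (¬¬-excluded-middle)
open import Relation.Nullary.Negation using (¬¬-map)

open import Defs

module IntegerCoefficientSolver {c ℓ} (R : CommutativeRing c ℓ) where
  open CommutativeRing R
  open import Algebra.Properties.Ring ring
  open import Algebra.Properties.CommutativeSemigroup +-commutativeSemigroup using (interchange)
  open import Algebra.Properties.Semiring.Mult semiring using (×-homo-1; ×-homo-+; ×1-homo-*)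
    renaming (_×_ to _·_)
  open import Relation.Binary.Reasoning.Setoid setoid

  private
    [x+y]-[z+w] : ∀ x y z w → (x + y) - (z + w) ≈ (x - z) + (y - w)
    [x+y]-[z+w] x y z w = begin
      (x + y) - (z + w)      ≈⟨ +-congˡ (-‿+-comm z w) ⟨
      (x + y) + (- z + - w)  ≈⟨ interchange x y (- z) (- w) ⟩
      (x - z) + (y - w)      ∎

    [x-y]-[z-w] : ∀ x y z w → (x - y) - (z - w) ≈ (x + w) - (z + y)
    [x-y]-[z-w] x y z w = begin
      (x - y) - (z - w)      ≈⟨ +-congˡ (⁻¹-anti-homo‿- z w) ⟩
      (x - y) + (w - z)      ≈⟨ interchange x (- y) w (- z) ⟩
      (x + w) + (- y + - z)  ≈⟨ +-congˡ (+-comm (- y) (- z)) ⟩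
      (x + w) + (- z + - y)  ≈⟨ +-congˡ (-‿+-comm z y) ⟩
      (x + w) - (z + y)      ∎

    [x-y][z-w] : ∀ x y z w → (x - y) * (z - w) ≈ (x * z + y * w) - (x * w + y * z)
    [x-y][z-w] x y z w = begin
      (x - y) * (z - w)                  ≈⟨ x[y-z]≈xy-xz (x - y) z w ⟩
      (x - y) * z - (x - y) * w          ≈⟨ +-cong ([y-z]x≈yx-zx z x y) (-‿cong ([y-z]x≈yx-zx w x y)) ⟩
      (x * z - y * z) - (x * w - y * w)  ≈⟨ [x-y]-[z-w] (x * z) (y * z) (x * w) (y * w) ⟩
      (x * z + y * w) - (x * w + y * z)  ∎

    -- An integer m - n is represented by the pair (m , n) with one component zero, so that
    -- coefficient arithmetic on closed numerals computes to a unique normal form.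
    normalise : ℕ → ℕ → ℕ × ℕ
    normalise m n = (m ∸ n , n ∸ m)

    coefficients : RawRing _ _
    coefficients = record
      { Carrier = ℕ × ℕ
      ; _≈_     = _≡_
      ; _+_     = λ { (m , n) (m′ , n′) → normalise (m ℕ.+ m′) (n ℕ.+ n′) }
      ; _*_     = λ { (m , n) (m′ , n′) → normalise (m ℕ.* m′ ℕ.+ n ℕ.* n′) (m ℕ.* n′ ℕ.+ n ℕ.* m′) }
      ; -_      = λ { (m , n) → (n , m) }
      ; 0#      = (0 , 0)
      ; 1#      = (1 , 0)
      }

    ⟦_⟧ : ℕ × ℕ → Carrier
    ⟦ m , n ⟧ = m · 1# - n · 1#

    ⟦normalise⟧ : ∀ m n → ⟦ normalise m n ⟧ ≈ m · 1# - n · 1#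
    ⟦normalise⟧ zero    zero    = refl
    ⟦normalise⟧ zero    (suc n) = refl
    ⟦normalise⟧ (suc m) zero    = refl
    ⟦normalise⟧ (suc m) (suc n) = begin
      ⟦ normalise m n ⟧              ≈⟨ ⟦normalise⟧ m n ⟩
      m · 1# - n · 1#                ≈⟨ +-identityˡ _ ⟨
      0# + (m · 1# - n · 1#)         ≈⟨ +-congʳ (-‿inverseʳ 1#) ⟨
      (1# - 1#) + (m · 1# - n · 1#)  ≈⟨ [x+y]-[z+w] 1# (m · 1#) 1# (n · 1#) ⟨
      suc m · 1# - suc n · 1#        ∎

    ·1-homo-+* : ∀ m m′ n n′ → (m ℕ.* m′ ℕ.+ n ℕ.* n′) · 1# ≈ m · 1# * m′ · 1# + n · 1# * n′ · 1#
    ·1-homo-+* m m′ n n′ = trans (×-homo-+ 1# (m ℕ.* m′) (n ℕ.* n′)) (+-cong (×1-homo-* m m′) (×1-homo-* n n′))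

    homomorphism : coefficients -Raw-AlmostCommutative⟶ fromCommutativeRing R
    homomorphism = record
      { ⟦_⟧    = ⟦_⟧
      ; +-homo = λ { (m , n) (m′ , n′) → begin
          ⟦ normalise (m ℕ.+ m′) (n ℕ.+ n′) ⟧     ≈⟨ ⟦normalise⟧ (m ℕ.+ m′) (n ℕ.+ n′) ⟩
          (m ℕ.+ m′) · 1# - (n ℕ.+ n′) · 1#       ≈⟨ +-cong (×-homo-+ 1# m m′) (-‿cong (×-homo-+ 1# n n′)) ⟩
          (m · 1# + m′ · 1#) - (n · 1# + n′ · 1#) ≈⟨ [x+y]-[z+w] _ _ _ _ ⟩
          ⟦ m , n ⟧ + ⟦ m′ , n′ ⟧                 ∎ }
      ; *-homo = λ { (m , n) (m′ , n′) → begin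
          ⟦ normalise (m ℕ.* m′ ℕ.+ n ℕ.* n′) (m ℕ.* n′ ℕ.+ n ℕ.* m′) ⟧
            ≈⟨ ⟦normalise⟧ (m ℕ.* m′ ℕ.+ n ℕ.* n′) (m ℕ.* n′ ℕ.+ n ℕ.* m′) ⟩
          (m ℕ.* m′ ℕ.+ n ℕ.* n′) · 1# - (m ℕ.* n′ ℕ.+ n ℕ.* m′) · 1#
            ≈⟨ +-cong (·1-homo-+* m m′ n n′) (-‿cong (·1-homo-+* m n′ n m′)) ⟩
          (m · 1# * m′ · 1# + n · 1# * n′ · 1#) - (m · 1# * n′ · 1# + n · 1# * m′ · 1#)
            ≈⟨ [x-y][z-w] _ _ _ _ ⟨
          ⟦ m , n ⟧ * ⟦ m′ , n′ ⟧                 ∎ }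
      ; -‿homo = λ { (m , n) → sym (⁻¹-anti-homo‿- (m · 1#) (n · 1#)) }
      ; 0-homo = -‿inverseʳ 0#
      ; 1-homo = trans (+-cong (×-homo-1 1#) -0#≈0#) (+-identityʳ 1#)
      }

    equal? : ∀ i j → Maybe (⟦ i ⟧ ≈ ⟦ j ⟧)
    equal? (m , n) (m′ , n′) with m ℕ.+ n′ ℕ.≟ m′ ℕ.+ n
    ... | no  _ = nothing
    ... | yes e = just (x∙y⁻¹≈ε⇒x≈y _ _ (begin
      (m · 1# - n · 1#) - (m′ · 1# - n′ · 1#) ≈⟨ [x-y]-[z-w] _ _ _ _ ⟩
      (m · 1# + n′ · 1#) - (m′ · 1# + n · 1#) ≈⟨ +-cong (×-homo-+ 1# m n′) (-‿cong (×-homo-+ 1# m′ n)) ⟨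
      (m ℕ.+ n′) · 1# - (m′ ℕ.+ n) · 1#       ≈⟨ x≈y⇒x∙y⁻¹≈ε (reflexive (≡.cong (_· 1#) e)) ⟩
      0#                                      ∎))

  open Algebra.Solver.Ring coefficients (fromCommutativeRing R) homomorphism equal? public
    using (solve; _:=_; _:+_; _:*_; :-_; _:-_)

+<+⇒<⊎< : ∀ {i j m n} → i ℕ.+ j < m ℕ.+ n → i < m ⊎ j < n
+<+⇒<⊎< {i} {j} {m} {n} i+j<m+n with i ℕ.<? m
... | yes i<m = inj₁ i<m
... | no  i≮m = inj₂ (ℕ.+-cancelˡ-< m j n (ℕ.≤-<-trans (ℕ.+-monoˡ-≤ j (ℕ.≮⇒≥ i≮m)) i+j<m+n))

¬¬-All : ∀ {a p} {A : Set a} {P : A → Set p} {xs} → All (λ x → ¬ ¬ P x) xs → ¬ ¬ All P xs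
¬¬-All []           k = k []
¬¬-All (¬¬p ∷ ¬¬ps) k = ¬¬p (λ p → ¬¬-All ¬¬ps (λ ps → k (p ∷ ps)))

length-─ : ∀ {a p} {A : Set a} {P : A → Set p} {xs} (p : Any.Any P xs) → length xs ≡ suc (length (xs ─ p))
length-─ {xs = xs} p = length-removeAt′ xs (Any.index p)

module Removal {a ℓ} (S : Setoid a ℓ) where
  open Setoid S
  open import Data.List.Membership.Setoid S using (_∈_)
  open import Data.List.Membership.Setoid.Properties using (∈-resp-≈; All[≉]⇒∉)
  open import Data.List.Relation.Unary.Unique.Setoid S using (Unique)

  ∈-─-split : ∀ {x y xs} (p : x ∈ xs) → y ∈ xs → y ≈ x ⊎ y ∈ (xs ─ p)
  ∈-─-split (here x≈z) (here y≈z) = inj₁ (trans y≈z (sym x≈z))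
  ∈-─-split (here _)   (there q)  = inj₂ q
  ∈-─-split (there p)  (here y≈z) = inj₂ (here y≈z)
  ∈-─-split (there p)  (there q)  = Sum.map₂ there (∈-─-split p q)

  Unique-─ : ∀ {x xs} (p : x ∈ xs) → Unique xs → Unique (x ∷ (xs ─ p))
  Unique-─ (here x≈z) (z≉zs ∷ u) = All.map (λ z≉w x≈w → z≉w (trans (sym x≈z) x≈w)) z≉zs ∷ u
  Unique-─ (there p)  (z≉zs ∷ u) with Unique-─ p u
  ... | x≉rest ∷ u′ = (x≉z ∷ x≉rest) ∷ ─⁺ p z≉zs ∷ u′
    where x≉z = λ x≈z → All[≉]⇒∉ S z≉zs (∈-resp-≈ S x≈z p)

  ─-elements : ∀ {x xs} (p : x ∈ xs) → Unique xs → All (λ y → x ≉ y × y ∈ xs) (xs ─ p)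
  ─-elements p u = All.zip (AllPairs-head (Unique-─ p u) , ─⁺ p (All.tabulateₛ S (λ y∈xs → y∈xs)))

module PolynomialFunctions {c ℓ} (R : CommutativeRing c ℓ) where
  open CommutativeRing R
  open import Algebra.Properties.Semiring.Exp semiring using (_^_)
  open import Data.List.Membership.Setoid setoid using (_∈_)
  open IntegerCoefficientSolver R

  data DegreeAtMost (D : ℕ) : (Carrier → Carrier → Carrier) → Set (c ⊔ ℓ) where
    monomial : ∀ k i j → i ℕ.+ j ≤ D → DegreeAtMost D (λ x y → k * (x ^ i * y ^ j))
    _⊕_      : ∀ {f g} → DegreeAtMost D f → DegreeAtMost D g → DegreeAtMost D (λ x y → f x y + g x y)
    resp     : ∀ {f g} → (∀ x y → f x y ≈ g x y) → DegreeAtMost D f → DegreeAtMost D g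

  degree-0# : ∀ {D} → DegreeAtMost D (λ _ _ → 0#)
  degree-0# = resp (λ _ _ → zeroˡ _) (monomial 0# 0 0 ℕ.z≤n)

  degree-weaken : ∀ {D D′ f} → D ≤ D′ → DegreeAtMost D f → DegreeAtMost D′ f
  degree-weaken D≤D′ (monomial k i j i+j≤D) = monomial k i j (ℕ.≤-trans i+j≤D D≤D′)
  degree-weaken D≤D′ (p ⊕ q)                = degree-weaken D≤D′ p ⊕ degree-weaken D≤D′ q
  degree-weaken D≤D′ (resp f≈g p)           = resp f≈g (degree-weaken D≤D′ p)

  degree-scale : ∀ {D f} k → DegreeAtMost D f → DegreeAtMost D (λ x y → k * f x y)
  degree-scale k (monomial k′ i j i+j≤D) = resp (λ _ _ → *-assoc k k′ _) (monomial (k * k′) i j i+j≤D)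
  degree-scale k (p ⊕ q)                 = resp (λ _ _ → sym (distribˡ k _ _)) (degree-scale k p ⊕ degree-scale k q)
  degree-scale k (resp f≈g p)            = resp (λ x y → *-congˡ (f≈g x y)) (degree-scale k p)

  degree-x* : ∀ {D f} → DegreeAtMost D f → DegreeAtMost (suc D) (λ x y → x * f x y)
  degree-x* (monomial k i j i+j≤D) =
    resp (λ x y → solve 4 (λ x k X Y → k :* ((x :* X) :* Y) := x :* (k :* (X :* Y))) refl x k (x ^ i) (y ^ j))
         (monomial k (suc i) j (s≤s i+j≤D))
  degree-x* (p ⊕ q)      = resp (λ x _ → sym (distribˡ x _ _)) (degree-x* p ⊕ degree-x* q)
  degree-x* (resp f≈g p) = resp (λ x y → *-congˡ (f≈g x y)) (degree-x* p)

  degree-y* : ∀ {D f} → DegreeAtMost D f → DegreeAtMost (suc D) (λ x y → y * f x y)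
  degree-y* (monomial k i j i+j≤D) =
    resp (λ x y → solve 4 (λ y k X Y → k :* (X :* (y :* Y)) := y :* (k :* (X :* Y))) refl y k (x ^ i) (y ^ j))
         (monomial k i (suc j) (ℕ.≤-trans (ℕ.≤-reflexive (ℕ.+-suc i j)) (s≤s i+j≤D)))
  degree-y* (p ⊕ q)      = resp (λ _ y → sym (distribˡ y _ _)) (degree-y* p ⊕ degree-y* q)
  degree-y* (resp f≈g p) = resp (λ x y → *-congˡ (f≈g x y)) (degree-y* p)

  degree-[x+y]* : ∀ {D f} → DegreeAtMost D f → DegreeAtMost (suc D) (λ x y → (x + y) * f x y)
  degree-[x+y]* p = resp (λ x y → sym (distribʳ _ x y)) (degree-x* p ⊕ degree-y* p)

  degree-term : ∀ {D} k i j → (D < i ℕ.+ j → k ≈ 0#) → DegreeAtMost D (λ x y → k * (x ^ i * y ^ j))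
  degree-term {D} k i j k≈0 with i ℕ.+ j ℕ.≤? D
  ... | yes i+j≤D = monomial k i j i+j≤D
  ... | no  i+j≰D = resp (λ _ _ → trans (sym (zeroˡ _)) (*-congʳ (sym (k≈0 (ℕ.≰⇒> i+j≰D))))) degree-0#

  ∏-sub : List Carrier → Carrier → Carrier
  ∏-sub []       s = 1#
  ∏-sub (c ∷ cs) s = (s - c) * ∏-sub cs s

  ∏-sub-≈0 : ∀ {s cs} → s ∈ cs → ∏-sub cs s ≈ 0#
  ∏-sub-≈0 {s} {c ∷ _} (here s≈c) = trans (*-congʳ (trans (+-congʳ s≈c) (-‿inverseʳ c))) (zeroˡ _)
  ∏-sub-≈0 (there s∈cs)           = trans (*-congˡ (∏-sub-≈0 s∈cs)) (zeroʳ _)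

  ∏-sub-degree : (u : Carrier → Carrier → Carrier) →
                 (∀ {D f} → DegreeAtMost D f → DegreeAtMost (suc D) (λ x y → u x y * f x y)) →
                 ∀ cs {D f} → DegreeAtMost D f → DegreeAtMost (length cs ℕ.+ D) (λ x y → ∏-sub cs (u x y) * f x y)
  ∏-sub-degree u u*-degree []       p = resp (λ _ _ → sym (*-identityˡ _)) p
  ∏-sub-degree u u*-degree (c ∷ cs) p =
    resp (λ x y → solve 4 (λ u c Π f → u :* (Π :* f) :+ (:- c) :* (Π :* f) := ((u :- c) :* Π) :* f)
                          refl (u x y) c (∏-sub cs (u x y)) _)
         (u*-degree q ⊕ degree-weaken (ℕ.n≤1+n _) (degree-scale (- c) q))
    where q = ∏-sub-degree u u*-degree cs p

module FieldProperties {c ℓ} (F : Field c ℓ) where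
  open Field F
  open import Algebra.Properties.Ring ring using (x∙y⁻¹≈ε⇒x≈y)
  open import Algebra.Properties.CommutativeSemigroup *-commutativeSemigroup using (xy∙z≈y∙xz)
  open import Relation.Binary.Reasoning.Setoid setoid
  open PolynomialFunctions commutativeRing using (∏-sub)

  inv : ∀ x → x ≉ 0# → Carrier
  inv x x≉0 = proj₁ (inverse x x≉0)

  x*inv≈1 : ∀ x (x≉0 : x ≉ 0#) → x * inv x x≉0 ≈ 1#
  x*inv≈1 x x≉0 = proj₂ (inverse x x≉0)

  inv-≉0 : ∀ x (x≉0 : x ≉ 0#) → inv x x≉0 ≉ 0#
  inv-≉0 x x≉0 inv≈0 = 1≉0 (trans (sym (x*inv≈1 x x≉0)) (trans (*-congˡ inv≈0) (zeroʳ x)))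

  x*y≈0⇒y≈0 : ∀ {x y} → x ≉ 0# → x * y ≈ 0# → y ≈ 0#
  x*y≈0⇒y≈0 {x} {y} x≉0 xy≈0 = begin
    y                ≈⟨ *-identityˡ y ⟨
    1# * y           ≈⟨ *-congʳ (x*inv≈1 x x≉0) ⟨
    (x * x⁻¹) * y    ≈⟨ xy∙z≈y∙xz x x⁻¹ y ⟩
    x⁻¹ * (x * y)    ≈⟨ *-congˡ xy≈0 ⟩
    x⁻¹ * 0#         ≈⟨ zeroʳ x⁻¹ ⟩
    0#               ∎
    where x⁻¹ = inv x x≉0

  *-≉0 : ∀ {x y} → x ≉ 0# → y ≉ 0# → x * y ≉ 0#
  *-≉0 x≉0 y≉0 xy≈0 = y≉0 (x*y≈0⇒y≈0 x≉0 xy≈0)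

  x-y≉0 : ∀ {x y} → x ≉ y → x - y ≉ 0#
  x-y≉0 x≉y x-y≈0 = x≉y (x∙y⁻¹≈ε⇒x≈y _ _ x-y≈0)

  ∏-sub-≉0 : ∀ {s cs} → All (s ≉_) cs → ∏-sub cs s ≉ 0#
  ∏-sub-≉0 []            = 1≉0
  ∏-sub-≉0 (s≉c ∷ s≉cs) = *-≉0 (x-y≉0 s≉c) (∏-sub-≉0 s≉cs)

module DividedDifferences {c ℓ} (F : Field c ℓ) where
  open Field F
  open FieldNotions F using (Unique)
  open import Algebra.Properties.Ring ring using (x∙y⁻¹≈ε⇒x≈y)
  open import Algebra.Properties.Semiring.Exp semiring using (_^_)
  open import Algebra.Properties.CommutativeSemigroup *-commutativeSemigroup using (xy∙z≈xz∙y)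
  open import Relation.Binary.Reasoning.Setoid setoid
  open IntegerCoefficientSolver commutativeRing
  open PolynomialFunctions commutativeRing
  open FieldProperties F

  divDiff : (Carrier → Carrier) → ∀ a rs → Unique (a ∷ rs) → Carrier
  divDiff g a []       _                  = g a
  divDiff g a (r ∷ rs) ((a≉r ∷ a≉rs) ∷ u) =
    (divDiff g a rs (a≉rs ∷ AllPairs-tail u) - divDiff g r rs u) * inv (a - r) (x-y≉0 a≉r)

  divDiff-cong : ∀ g h → (∀ x → g x ≈ h x) → ∀ a rs u → divDiff g a rs u ≈ divDiff h a rs u
  divDiff-cong g h g≈h a []       _                  = g≈h a
  divDiff-cong g h g≈h a (r ∷ rs) ((a≉r ∷ a≉rs) ∷ u) =
    *-congʳ (+-cong (divDiff-cong g h g≈h a rs (a≉rs ∷ AllPairs-tail u)) (-‿cong (divDiff-cong g h g≈h r rs u)))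

  divDiff-+ : ∀ g h a rs u → divDiff (λ x → g x + h x) a rs u ≈ divDiff g a rs u + divDiff h a rs u
  divDiff-+ g h a []       _                  = refl
  divDiff-+ g h a (r ∷ rs) ((a≉r ∷ a≉rs) ∷ u) = begin
    (divDiff (λ x → g x + h x) a rs u′ - divDiff (λ x → g x + h x) r rs u) * i
      ≈⟨ *-congʳ (+-cong (divDiff-+ g h a rs u′) (-‿cong (divDiff-+ g h r rs u))) ⟩
    ((divDiff g a rs u′ + divDiff h a rs u′) - (divDiff g r rs u + divDiff h r rs u)) * i
      ≈⟨ solve 5 (λ p q s t i → ((p :+ q) :- (s :+ t)) :* i := (p :- s) :* i :+ (q :- t) :* i) refl _ _ _ _ i ⟩
    (divDiff g a rs u′ - divDiff g r rs u) * i + (divDiff h a rs u′ - divDiff h r rs u) * i ∎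
    where u′ = a≉rs ∷ AllPairs-tail u
          i  = inv (a - r) (x-y≉0 a≉r)

  divDiff-* : ∀ k g a rs u → divDiff (λ x → k * g x) a rs u ≈ k * divDiff g a rs u
  divDiff-* k g a []       _                  = refl
  divDiff-* k g a (r ∷ rs) ((a≉r ∷ a≉rs) ∷ u) = begin
    (divDiff (λ x → k * g x) a rs u′ - divDiff (λ x → k * g x) r rs u) * i
      ≈⟨ *-congʳ (+-cong (divDiff-* k g a rs u′) (-‿cong (divDiff-* k g r rs u))) ⟩
    (k * divDiff g a rs u′ - k * divDiff g r rs u) * i
      ≈⟨ solve 4 (λ k p s i → (k :* p :- k :* s) :* i := k :* ((p :- s) :* i)) refl k _ _ i ⟩
    k * ((divDiff g a rs u′ - divDiff g r rs u) * i) ∎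
    where u′ = a≉rs ∷ AllPairs-tail u
          i  = inv (a - r) (x-y≉0 a≉r)

  divDiff-const≈0 : ∀ k a r rs u → divDiff (λ _ → k) a (r ∷ rs) u ≈ 0#
  divDiff-const≈0 k a r []       ((a≉r ∷ []) ∷ _) = trans (*-congʳ (-‿inverseʳ k)) (zeroˡ _)
  divDiff-const≈0 k a r (s ∷ rs) ((a≉r ∷ a≉s∷rs) ∷ u) = begin
    (divDiff (λ _ → k) a (s ∷ rs) u′ - divDiff (λ _ → k) r (s ∷ rs) u) * i
      ≈⟨ *-congʳ (+-cong (divDiff-const≈0 k a s rs u′) (-‿cong (divDiff-const≈0 k r s rs u))) ⟩
    (0# - 0#) * i  ≈⟨ *-congʳ (-‿inverseʳ 0#) ⟩
    0# * i         ≈⟨ zeroˡ i ⟩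
    0#             ∎
    where u′ = a≉s∷rs ∷ AllPairs-tail u
          i  = inv (a - r) (x-y≉0 a≉r)

  leibniz-step : ∀ {a r A B S i} → (a - r) * i ≈ 1# →
                 ((a * A + S) - (r * B + S)) * i ≈ a * ((A - B) * i) + B
  leibniz-step {a} {r} {A} {B} {S} {i} [a-r]i≈1 = begin
    ((a * A + S) - (r * B + S)) * i     ≈⟨ solve 6 (λ a r A B S i → ((a :* A :+ S) :- (r :* B :+ S)) :* i
                                                    := a :* ((A :- B) :* i) :+ ((a :- r) :* i) :* B) refl a r A B S i ⟩
    a * ((A - B) * i) + ((a - r) * i) * B  ≈⟨ +-congˡ (trans (*-congʳ [a-r]i≈1) (*-identityˡ B)) ⟩
    a * ((A - B) * i) + B               ∎

  divDiff-x* : ∀ g a r rs u →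
    divDiff (λ x → x * g x) a (r ∷ rs) u ≈ a * divDiff g a (r ∷ rs) u + divDiff g r rs (AllPairs-tail u)
  divDiff-x* g a r []       ((a≉r ∷ []) ∷ u) = begin
    (a * g a - r * g r) * i                     ≈⟨ *-congʳ (+-cong (+-identityʳ _) (-‿cong (+-identityʳ _))) ⟨
    ((a * g a + 0#) - (r * g r + 0#)) * i       ≈⟨ leibniz-step (x*inv≈1 (a - r) (x-y≉0 a≉r)) ⟩
    a * ((g a - g r) * i) + g r                 ∎
    where i = inv (a - r) (x-y≉0 a≉r)
  divDiff-x* g a r (s ∷ rs) ((a≉r ∷ a≉s∷rs) ∷ u) = begin
    (divDiff (λ x → x * g x) a (s ∷ rs) u′ - divDiff (λ x → x * g x) r (s ∷ rs) u) * i
      ≈⟨ *-congʳ (+-cong (divDiff-x* g a s rs u′) (-‿cong (divDiff-x* g r s rs u))) ⟩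
    ((a * divDiff g a (s ∷ rs) u′ + divDiff g s rs (AllPairs-tail u))
       - (r * divDiff g r (s ∷ rs) u + divDiff g s rs (AllPairs-tail u))) * i
      ≈⟨ leibniz-step (x*inv≈1 (a - r) (x-y≉0 a≉r)) ⟩
    a * ((divDiff g a (s ∷ rs) u′ - divDiff g r (s ∷ rs) u) * i) + divDiff g r (s ∷ rs) u ∎
    where u′ = a≉s∷rs ∷ AllPairs-tail u
          i  = inv (a - r) (x-y≉0 a≉r)

  divDiff-^≈0 : ∀ k a rs u → k < length rs → divDiff (_^ k) a rs u ≈ 0#
  divDiff-^≈0 zero    a (r ∷ rs) u _ = divDiff-const≈0 1# a r rs u
  divDiff-^≈0 (suc k) a (r ∷ rs) u (s≤s k<rs) = begin
    divDiff (λ x → x * x ^ k) a (r ∷ rs) u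
      ≈⟨ divDiff-x* (_^ k) a r rs u ⟩
    a * divDiff (_^ k) a (r ∷ rs) u + divDiff (_^ k) r rs (AllPairs-tail u)
      ≈⟨ +-cong (*-congˡ (divDiff-^≈0 k a (r ∷ rs) u (ℕ.m≤n⇒m≤1+n k<rs)))
                (divDiff-^≈0 k r rs (AllPairs-tail u) k<rs) ⟩
    a * 0# + 0#  ≈⟨ trans (+-identityʳ _) (zeroʳ a) ⟩
    0#           ∎

  divDiff-vanish : ∀ g a rs u → All (λ x → g x ≈ 0#) (a ∷ rs) → divDiff g a rs u ≈ 0#
  divDiff-vanish g a []       _                  (ga≈0 ∷ [])         = ga≈0
  divDiff-vanish g a (r ∷ rs) ((a≉r ∷ a≉rs) ∷ u) (ga≈0 ∷ gr≈0 ∷ g≈0) = begin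
    (divDiff g a rs (a≉rs ∷ AllPairs-tail u) - divDiff g r rs u) * i
      ≈⟨ *-congʳ (+-cong (divDiff-vanish g a rs _ (ga≈0 ∷ g≈0))
                         (-‿cong (divDiff-vanish g r rs u (gr≈0 ∷ g≈0)))) ⟩
    (0# - 0#) * i  ≈⟨ *-congʳ (-‿inverseʳ 0#) ⟩
    0# * i         ≈⟨ zeroˡ i ⟩
    0#             ∎
    where i = inv (a - r) (x-y≉0 a≉r)

  divDiff-≉0 : ∀ g a rs u → g a ≉ 0# → All (λ r → g r ≈ 0#) rs → divDiff g a rs u ≉ 0#
  divDiff-≉0 g a []       _                  ga≉0 []            = ga≉0
  divDiff-≉0 g a (r ∷ rs) ((a≉r ∷ a≉rs) ∷ u) ga≉0 (gr≈0 ∷ g≈0) =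
    *-≉0 (λ d≈0 → divDiff-≉0 g a rs u′ ga≉0 g≈0 (trans (x∙y⁻¹≈ε⇒x≈y _ _ d≈0) gr≈0′)) (inv-≉0 _ _)
    where u′    = a≉rs ∷ AllPairs-tail u
          gr≈0′ = divDiff-vanish g r rs u (gr≈0 ∷ g≈0)

  module Grid (a : Carrier) (as : List Carrier) (u : Unique (a ∷ as))
              (b : Carrier) (bs : List Carrier) (v : Unique (b ∷ bs)) where

    divDiff₂ : (Carrier → Carrier → Carrier) → Carrier
    divDiff₂ f = divDiff (λ x → divDiff (f x) b bs v) a as u

    divDiff₂-≉0 : ∀ f → f a b ≉ 0# → All (λ y → f a y ≈ 0#) bs →
                  All (λ x → All (λ y → f x y ≈ 0#) (b ∷ bs)) as → divDiff₂ f ≉ 0#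
    divDiff₂-≉0 f fab≉0 fa≈0 f≈0 =
      divDiff-≉0 _ a as u (divDiff-≉0 (f a) b bs v fab≉0 fa≈0)
                 (All.map (λ {x} → divDiff-vanish (f x) b bs v) f≈0)

    divDiff-monomial : ∀ k i j x →
      divDiff (λ y → k * (x ^ i * y ^ j)) b bs v ≈ (k * x ^ i) * divDiff (_^ j) b bs v
    divDiff-monomial k i j x =
      trans (divDiff-cong _ _ (λ y → sym (*-assoc k (x ^ i) (y ^ j))) b bs v) (divDiff-* _ _ b bs v)

    divDiff₂-+ : ∀ f g → divDiff₂ (λ x y → f x y + g x y) ≈ divDiff₂ f + divDiff₂ g
    divDiff₂-+ f g = trans (divDiff-cong _ _ (λ x → divDiff-+ (f x) (g x) b bs v) a as u) (divDiff-+ _ _ a as u)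

    divDiff₂-cong : ∀ f g → (∀ x y → f x y ≈ g x y) → divDiff₂ f ≈ divDiff₂ g
    divDiff₂-cong f g f≈g = divDiff-cong _ _ (λ x → divDiff-cong (f x) (g x) (f≈g x) b bs v) a as u

    divDiff₂-degree≈0 : ∀ {D f} → DegreeAtMost D f → D < length as ℕ.+ length bs → divDiff₂ f ≈ 0#
    divDiff₂-degree≈0 (monomial k i j i+j≤D) D<as+bs with +<+⇒<⊎< (ℕ.≤-<-trans i+j≤D D<as+bs)
    ... | inj₁ i<as = begin
      divDiff (λ x → divDiff (λ y → k * (x ^ i * y ^ j)) b bs v) a as u
        ≈⟨ divDiff-cong _ _ (λ x → trans (divDiff-monomial k i j x) (xy∙z≈xz∙y k (x ^ i) _)) a as u ⟩
      divDiff (λ x → (k * divDiff (_^ j) b bs v) * x ^ i) a as u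
        ≈⟨ divDiff-* _ (_^ i) a as u ⟩
      (k * divDiff (_^ j) b bs v) * divDiff (_^ i) a as u
        ≈⟨ *-congˡ (divDiff-^≈0 i a as u i<as) ⟩
      (k * divDiff (_^ j) b bs v) * 0#  ≈⟨ zeroʳ _ ⟩
      0#                                ∎
    ... | inj₂ j<bs = divDiff-vanish _ a as u (All.universal (λ x → begin
      divDiff (λ y → k * (x ^ i * y ^ j)) b bs v  ≈⟨ divDiff-monomial k i j x ⟩
      (k * x ^ i) * divDiff (_^ j) b bs v         ≈⟨ *-congˡ (divDiff-^≈0 j b bs v j<bs) ⟩
      (k * x ^ i) * 0#                            ≈⟨ zeroʳ _ ⟩
      0#                                          ∎) (a ∷ as))
    divDiff₂-degree≈0 (_⊕_ {f} {g} p q) D<as+bs = begin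
      divDiff₂ (λ x y → f x y + g x y)  ≈⟨ divDiff₂-+ f g ⟩
      divDiff₂ f + divDiff₂ g           ≈⟨ +-cong (divDiff₂-degree≈0 p D<as+bs) (divDiff₂-degree≈0 q D<as+bs) ⟩
      0# + 0#                           ≈⟨ +-identityʳ 0# ⟩
      0#                                ∎
    divDiff₂-degree≈0 (resp {f} {g} f≈g p) D<as+bs =
      trans (sym (divDiff₂-cong f g f≈g)) (divDiff₂-degree≈0 p D<as+bs)

module Evaluation {c ℓ} (F : Field c ℓ) where
  open Field F
  open FieldNotions F
  open import Algebra.Properties.Semiring.Exp semiring using (_^_)
  open IntegerCoefficientSolver commutativeRing
  open PolynomialFunctions commutativeRing

  row-degree : ∀ r i j {D} → (∀ j′ → D < i ℕ.+ j ℕ.+ j′ → lookupD r j′ ≈ 0#) →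
               DegreeAtMost D (λ x y → x ^ i * (y ^ j * evalRow r y))
  row-degree []      i j     _ = resp (λ _ _ → sym (trans (*-congˡ (zeroʳ _)) (zeroʳ _))) degree-0#
  row-degree (k ∷ r) i j {D} h =
    resp (λ x y → solve 5 (λ k X Y y E → k :* (X :* Y) :+ X :* ((y :* Y) :* E) := X :* (Y :* (k :+ y :* E)))
                          refl k (x ^ i) (y ^ j) y (evalRow r y))
         (degree-term k i j (λ D<i+j → h 0 (≡.subst (D <_) (≡.sym (ℕ.+-identityʳ _)) D<i+j))
          ⊕ row-degree r i (suc j) (λ j′ → h (suc j′) ∘ ≡.subst (D <_) (shift j′)))
    where
    shift : ∀ j′ → i ℕ.+ suc j ℕ.+ j′ ≡ i ℕ.+ j ℕ.+ suc j′
    shift j′ = ≡.trans (≡.cong (ℕ._+ j′) (ℕ.+-suc i j)) (≡.sym (ℕ.+-suc (i ℕ.+ j) j′))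

  rows-degree : ∀ P i {D} → (∀ i′ j → D < i ℕ.+ i′ ℕ.+ j → coeff P i′ j ≈ 0#) →
                DegreeAtMost D (λ x y → x ^ i * eval P x y)
  rows-degree []      i     _ = resp (λ _ _ → sym (zeroʳ _)) degree-0#
  rows-degree (r ∷ P) i {D} h =
    resp (λ x y → trans (+-congʳ (*-congˡ (*-identityˡ _)))
                        (solve 4 (λ X R x E → X :* R :+ (x :* X) :* E := X :* (R :+ x :* E))
                               refl (x ^ i) (evalRow r y) x (eval P x y)))
         (row-degree r i 0 (h 0) ⊕ rows-degree P (suc i) (λ i′ j → h (suc i′) j ∘ ≡.subst (D <_) (shift i′ j)))
    where
    shift : ∀ i′ j → suc i ℕ.+ i′ ℕ.+ j ≡ i ℕ.+ suc i′ ℕ.+ j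
    shift i′ j = ≡.cong (ℕ._+ j) (≡.sym (ℕ.+-suc i i′))

  eval-degree : ∀ P {d} → HasDegree P d → DegreeAtMost d (eval P)
  eval-degree P (high≈0 , _) = resp (λ _ _ → *-identityˡ _) (rows-degree P 0 high≈0)

<-after-removal : ∀ {A B C N a b c n} d → A ≡ suc a → B ≡ suc b → C ≡ suc c → N ≡ suc n →
                  C ℕ.+ d ℕ.+ N < A ℕ.+ B → n ℕ.+ (c ℕ.+ d) < a ℕ.+ b
<-after-removal {a = a} {b} {c} {n} d ≡.refl ≡.refl ≡.refl ≡.refl lt =
  ℕ.s<s⁻¹ (ℕ.s<s⁻¹ (≡.subst₂ _<_ (lhs c d n) (rhs a b) lt))
  where
  lhs : ∀ c d n → suc c ℕ.+ d ℕ.+ suc n ≡ 2 ℕ.+ (n ℕ.+ (c ℕ.+ d))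
  lhs = solve-∀
  rhs : ∀ a b → suc a ℕ.+ suc b ≡ 2 ℕ.+ (a ℕ.+ b)
  rhs = solve-∀

module RestrictedSumsets {c ℓ} (F : Field c ℓ) where
  open Field F
  open FieldNotions F
  open FieldProperties F
  open DividedDifferences F
  open PolynomialFunctions commutativeRing
  open Evaluation F
  open import Algebra.Properties.Ring ring using (+-cancelˡ)
  open Removal setoid
  module R² = Removal pairSetoid
  open import Relation.Binary.Reasoning.Setoid setoid

  RestrictedSumset : List Carrier → List Carrier → Poly → List Carrier → Set (c ⊔ ℓ)
  RestrictedSumset A B P C = ∀ z → z ∈ C ⇔ (∃[ a ] ∃[ b ] (a ∈ A × b ∈ B × ¬ (eval P a b ≈ 0#) × z ≈ a + b))

  Representations : List Carrier → List Carrier → Carrier → List (Carrier × Carrier) → Set (c ⊔ ℓ)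
  Representations A B z N = ∀ p → p ∈² N ⇔ (let (a , b) = p in a ∈ A × b ∈ B × a + b ≈ z)

  module _ {A B : List Carrier} (uA : Unique A) (uB : Unique B)
           (P : Poly) {d : ℕ} (P-deg : HasDegree P d)
           {C : List Carrier} (uC : Unique C) (C-spec : RestrictedSumset A B P C)
           {z : Carrier} (z∈C : z ∈ C)
           {N : List (Carrier × Carrier)} (uN : Unique² N) (N-spec : Representations A B z N)
           {a₀ b₀ : Carrier} (a₀∈A : a₀ ∈ A) (b₀∈B : b₀ ∈ B)
           (Pa₀b₀≉0 : eval P a₀ b₀ ≉ 0#) (z≈a₀+b₀ : z ≈ a₀ + b₀) where

    private
      A′ B′ C′ : List Carrier
      A′ = A ─ a₀∈A
      B′ = B ─ b₀∈B
      C′ = C ─ z∈C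

      a₀b₀∈N : (a₀ , b₀) ∈² N
      a₀b₀∈N = Equivalence.from (N-spec (a₀ , b₀)) (a₀∈A , b₀∈B , sym z≈a₀+b₀)

      N′ : List (Carrier × Carrier)
      N′ = N ─ a₀b₀∈N

      f : Carrier → Carrier → Carrier
      f x y = ∏-sub (map proj₁ N′) x * (∏-sub C′ (x + y) * eval P x y)

      f-degree : DegreeAtMost (length (map proj₁ N′) ℕ.+ (length C′ ℕ.+ d)) f
      f-degree = ∏-sub-degree (λ x _ → x) degree-x* (map proj₁ N′)
                   (∏-sub-degree _+_ degree-[x+y]* C′ (eval-degree P P-deg))

      f-corner : f a₀ b₀ ≉ 0#
      f-corner = *-≉0 (∏-sub-≉0 (All.map⁺ (All.map a₀≉proj₁ (R².─-elements a₀b₀∈N uN))))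
                      (*-≉0 (∏-sub-≉0 (All.map a₀+b₀≉ (AllPairs-head (Unique-─ z∈C uC)))) Pa₀b₀≉0)
        where
        a₀+b₀≉ : ∀ {w} → z ≉ w → a₀ + b₀ ≉ w
        a₀+b₀≉ z≉w a₀+b₀≈w = z≉w (trans z≈a₀+b₀ a₀+b₀≈w)
        a₀≉proj₁ : ∀ {q} → ¬ (a₀ ≈ proj₁ q × b₀ ≈ proj₂ q) × q ∈² N → a₀ ≉ proj₁ q
        a₀≉proj₁ {q₁ , q₂} (a₀b₀≉q , q∈N) a₀≈q₁ = a₀b₀≉q (a₀≈q₁ , sym (+-cancelˡ a₀ q₂ b₀ (begin
          a₀ + q₂  ≈⟨ +-congʳ a₀≈q₁ ⟩
          q₁ + q₂  ≈⟨ proj₂ (proj₂ (Equivalence.to (N-spec (q₁ , q₂)) q∈N)) ⟩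
          z        ≈⟨ z≈a₀+b₀ ⟩
          a₀ + b₀  ∎)))

      f-vanishes : ∀ {x y} → x ∈ A → y ∈ B → ¬ (x ≈ a₀ × y ≈ b₀) → ¬ ¬ (f x y ≈ 0#)
      f-vanishes {x} {y} x∈A y∈B ¬corner = ¬¬-map vanish ¬¬-excluded-middle
        where
        vanish : Dec (eval P x y ≈ 0#) → f x y ≈ 0#
        vanish (yes Pxy≈0) = trans (*-congˡ (trans (*-congˡ Pxy≈0) (zeroʳ _))) (zeroʳ _)
        vanish (no  Pxy≉0) with ∈-─-split z∈C (Equivalence.from (C-spec (x + y)) (x , y , x∈A , y∈B , Pxy≉0 , refl))
        ... | inj₂ x+y∈C′ = trans (*-congˡ (trans (*-congʳ (∏-sub-≈0 x+y∈C′)) (zeroˡ _))) (zeroʳ _)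
        ... | inj₁ x+y≈z with R².∈-─-split a₀b₀∈N (Equivalence.from (N-spec (x , y)) (x∈A , y∈B , x+y≈z))
        ...   | inj₁ xy≈a₀b₀ = ⊥-elim (¬corner xy≈a₀b₀)
        ...   | inj₂ xy∈N′   = trans (*-congʳ (∏-sub-≈0 (Any.map⁺ (Any.map proj₁ xy∈N′)))) (zeroˡ _)

      vanishes-on-row : ¬ ¬ All (λ y → f a₀ y ≈ 0#) B′
      vanishes-on-row = ¬¬-All (All.map (λ (b₀≉y , y∈B) → f-vanishes a₀∈A y∈B (b₀≉y ∘ sym ∘ proj₂))
                                        (─-elements b₀∈B uB))

      vanishes-off-row : ¬ ¬ All (λ x → All (λ y → f x y ≈ 0#) (b₀ ∷ B′)) A′
      vanishes-off-row = ¬¬-All (All.map column (─-elements a₀∈A uA))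
        where
        column : ∀ {x} → a₀ ≉ x × x ∈ A → ¬ ¬ All (λ y → f x y ≈ 0#) (b₀ ∷ B′)
        column (a₀≉x , x∈A) = ¬¬-All (All.map (λ y∈B → f-vanishes x∈A y∈B (a₀≉x ∘ sym ∘ proj₁))
                                              (b₀∈B ∷ All.map proj₂ (─-elements b₀∈B uB)))

      small-degree : length C ℕ.+ d ℕ.+ length N < length A ℕ.+ length B →
                     length (map proj₁ N′) ℕ.+ (length C′ ℕ.+ d) < length A′ ℕ.+ length B′
      small-degree = <-after-removal d (length-─ a₀∈A) (length-─ b₀∈B) (length-─ z∈C)
                       (≡.trans (length-─ a₀b₀∈N) (≡.cong suc (≡.sym (length-map proj₁ N′))))

    no-large-grid : ¬ (length C ℕ.+ d ℕ.+ length N < length A ℕ.+ length B)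
    no-large-grid lt =
      vanishes-on-row λ row≈0 → vanishes-off-row λ rest≈0 →
      divDiff₂-≉0 f f-corner row≈0 rest≈0 (divDiff₂-degree≈0 f-degree (small-degree lt))
      where open Grid a₀ A′ (Unique-─ a₀∈A uA) b₀ B′ (Unique-─ b₀∈B uB)

theorem1p1 : ∀ {c ℓ} (F : Field c ℓ) →
    let open Field F in let open FieldNotions F in
    (A B : List Carrier) → Unique A → Unique B →
    ∃[ a ] (a ∈ A) → ∃[ b ] (b ∈ B) →
    (P : Poly) (d : ℕ) → HasDegree P d →
    (C : List Carrier) → Unique C →
    (∀ z → z ∈ C ⇔ (∃[ a ] ∃[ b ] (a ∈ A × b ∈ B × ¬ (eval P a b ≈ 0#) × z ≈ a + b))) →
    ∃[ z ] (z ∈ C) →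
    -- |C| ≥ |A| + |B| - deg P - min_{z ∈ C} ν(z), i.e. for every z ∈ C and
    -- every listing N of {(a,b) ∈ A × B : a + b = z} (so |N| = ν(z)):
    ∀ z → z ∈ C →
    (N : List (Carrier × Carrier)) → Unique² N →
    (∀ p → p ∈² N ⇔ (let (a , b) = p in a ∈ A × b ∈ B × a + b ≈ z)) →
    length A ℕ.+ length B ℕ.≤ length C ℕ.+ d ℕ.+ length N
theorem1p1 F A B uA uB _ _ P d P-deg C uC C-spec _ z z∈C N uN N-spec
  with Equivalence.to (C-spec z) z∈C
... | a₀ , b₀ , a₀∈A , b₀∈B , Pa₀b₀≉0 , z≈a₀+b₀ =
  ℕ.≮⇒≥ (RestrictedSumsets.no-large-grid F uA uB P P-deg uC C-spec z∈C uN N-spec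
                                          a₀∈A b₀∈B Pa₀b₀≉0 z≈a₀+b₀)
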